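{- Every elementary cycle with arborescences is a separable graph.
   Context: An elementary cycle with arborescences is a finite simple graph obtained from an elementary cycle $C_l$ ($l\ge 3$) by attaching one or several trees hanging from vertices of the cycle; equivalently, a connected graph containing exactly one cycle. A graph $G=(V,E)$ is separable if there exist non-negative real weights $w(e)$, $e\in E$, and a threshold $\alpha\in\mathbb{R}$ such that for every $E'\subseteq E$: $\sum_{e\in E'}w(e)\ge\alpha$ if and only if the spanning subgraph $(V,E')$ is connected. -}

module Defs where

open import Data.Nat using (ℕ; zero; suc; _≤_)
open import Data.Fin using (Fin; zero; suc; inject₁; fromℕ)
open import Data.Bool using (if_then_else_)
open import Data.List using (List; foldr; map; allFin)
open import Data.Product using (Σ; ∃; ∃-syntax; _×_; _,_; proj₁; proj₂)
open import Data.Sum using (_⊎_)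
open import Data.Rational using (ℚ; 0ℚ; _+_) renaming (_≤_ to _≤ℚ_)
open import Data.Fin.Subset using (Subset; _∈_; ⊤)
open import Data.Vec using (lookup)
open import Function.Bundles using (_⇔_)
open import Relation.Binary.PropositionalEquality using (_≡_; _≢_)
open import Relation.Binary.Construct.Closure.ReflexiveTransitive using (Star)

SameEnds : ∀ {n} → Fin n × Fin n → Fin n × Fin n → Set
SameEnds (a , b) (c , d) = (a ≡ c × b ≡ d) ⊎ (a ≡ d × b ≡ c)

record Graph : Set where
  field
    n : ℕ
    m : ℕ
    ends : Fin m → Fin n × Fin n
    loopless : ∀ e → proj₁ (ends e) ≢ proj₂ (ends e)
    simple : ∀ e f → SameEnds (ends e) (ends f) → e ≡ f

module _ (G : Graph) where
  open Graph G

  Step : Subset m → Fin n → Fin n → Set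
  Step S u v = ∃[ e ] (e ∈ S × SameEnds (ends e) (u , v))

  ConnectedSub : Subset m → Set
  ConnectedSub S = ∀ u v → Star (Step S) u v

  Connected : Set
  Connected = ConnectedSub ⊤

  Adj : Fin n → Fin n → Set
  Adj = Step ⊤

  -- an elementary cycle of length l = suc k ≥ 3: distinct vertices vs 0 … vs k,
  -- consecutive ones (cyclically) adjacent
  record Cycle : Set where
    field
      k : ℕ
      len≥3 : 2 ≤ k
      vs : Fin (suc k) → Fin n
      distinct : ∀ i j → vs i ≡ vs j → i ≡ j
      consec : ∀ (i : Fin k) → Adj (vs (inject₁ i)) (vs (suc i))
      wrap : Adj (vs (fromℕ k)) (vs zero)

  CycleEdge : Cycle → Fin m → Set
  CycleEdge c e =
    (∃[ i ] SameEnds (ends e) (vs (inject₁ i) , vs (suc i)))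
    ⊎ SameEnds (ends e) (vs (fromℕ k) , vs zero)
    where open Cycle c

  -- connected graph containing exactly one cycle (cycles identified with their edge sets)
  ElementaryCycleWithArborescences : Set
  ElementaryCycleWithArborescences =
    Connected × (Σ Cycle λ c → ∀ (c′ : Cycle) → ∀ e → CycleEdge c e ⇔ CycleEdge c′ e)

  weight : (Fin m → ℚ) → Subset m → ℚ
  weight w S = foldr _+_ 0ℚ (map (λ e → if lookup S e then w e else 0ℚ) (allFin m))

  Separable : Set
  Separable =
    Σ (Fin m → ℚ) λ w → (∀ e → 0ℚ ≤ℚ w e) ×
      Σ ℚ λ α → ∀ (S : Subset m) → (α ≤ℚ weight w S) ⇔ ConnectedSub S

{-# OPTIONS --safe #-}

-- Weight the edges of the cycle 1 and all other edges 2, and take the total weight minus 1 as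
-- threshold. A spanning subgraph reaches it exactly when it omits at most one edge and that edge
-- lies on the cycle. Omitting one cycle edge keeps the graph connected: the rest of the cycle
-- joins its ends. Conversely, if a connected spanning subgraph omits an edge e, a path in it
-- between the ends of e closes a cycle through e all of whose other edges are kept. By uniqueness
-- this is the cycle, so e lies on the cycle, and any other omitted edge, lying on the cycle too,
-- would have to be kept.

module Submission where

open import Defs

open import Data.Bool using (true; false; if_then_else_)
open import Data.Bool.Properties using (if-float)
open import Data.Fin using (Fin; zero; suc; inject₁; fromℕ; toℕ; _≟_)
  renaming (_<_ to _<ᶠ_; _≤_ to _≤ᶠ_)
open import Data.Fin.Properties
  using (any?; <⇒≢; suc-injective; inject₁-injective; toℕ-inject₁; toℕ-fromℕ; fromℕ≢inject₁)
open import Data.Fin.Subset using (Subset; _∈_; _∉_; ⊤)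
open import Data.Fin.Subset.Properties using (_∈?_; ∈⊤)
open import Data.Integer as ℤ using (+_)
import Data.Integer.Properties as ℤ
open import Data.List using (foldr; map; allFin; tabulate)
open import Data.List.Properties using (map-cong; map-tabulate)
open import Data.Nat using (ℕ; zero; suc; _+_; _∸_; _≤_; _<_; z≤n; s≤s)
import Data.Nat.Properties as ℕ
open import Algebra.Properties.CommutativeMonoid.Sum ℕ.+-0-commutativeMonoid
  using (sum; ∑-distrib-+; sum-cong-≗; sum-replicate-zero)
open import Data.Product using (Σ; _×_; _,_; proj₁; proj₂)
open import Data.Rational as ℚ using (ℚ; 0ℚ; *≤*)
open import Data.Rational.Literals using (fromℤ)
open import Data.Rational.Properties using (toℚᵘ-injective; toℚᵘ-homo-+)
import Data.Rational.Unnormalised as ℚᵘ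
import Data.Rational.Unnormalised.Properties as ℚᵘ
open import Data.Sum using (_⊎_; inj₁; inj₂)
open import Data.Unit using (tt) renaming (⊤ to Unit)
open import Data.Vec using (lookup)
open import Data.Vec.Properties using ([]=⇒lookup; lookup⇒[]=)
open import Function using (_∘_)
open import Function.Bundles using (_⇔_; mk⇔; Equivalence)
open import Function.Construct.Composition using (_⇔-∘_)
open import Function.Related.Propositional using (module EquationalReasoning; equivalence)
open import Level using (0ℓ)
open import Relation.Binary using (Rel; DecidableEquality)
open import Relation.Binary.PropositionalEquality
open import Relation.Binary.Construct.Closure.ReflexiveTransitive
  using (Star; ε; _◅_; _◅◅_; reverse; return; _⋆)
open import Relation.Nullary using (Dec; yes; no; ¬_; does; contradiction)
open import Relation.Nullary.Decidable using (_×-dec_; _⊎-dec_)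
open import Relation.Unary using (Decidable)

ℕ→ℚ : ℕ → ℚ
ℕ→ℚ a = fromℤ (+ a)

ℕ→ℚ-homo-+ : ∀ a b → ℕ→ℚ (a + b) ≡ ℕ→ℚ a ℚ.+ ℕ→ℚ b
ℕ→ℚ-homo-+ a b =
  toℚᵘ-injective (ℚᵘ.≃-sym (ℚᵘ.≃-trans (toℚᵘ-homo-+ (ℕ→ℚ a) (ℕ→ℚ b)) (ℚᵘ.*≡* eq)))
  where
  open ≡-Reasoning
  eq : (+ a ℤ.* + 1 ℤ.+ + b ℤ.* + 1) ℤ.* + 1 ≡ + (a + b) ℤ.* (+ 1 ℤ.* + 1)
  eq = begin
    (+ a ℤ.* + 1 ℤ.+ + b ℤ.* + 1) ℤ.* + 1 ≡⟨ ℤ.*-identityʳ _ ⟩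
    + a ℤ.* + 1 ℤ.+ + b ℤ.* + 1           ≡⟨ cong₂ ℤ._+_ (ℤ.*-identityʳ (+ a)) (ℤ.*-identityʳ (+ b)) ⟩
    + (a + b)                             ≡⟨ ℤ.*-identityʳ _ ⟨
    + (a + b) ℤ.* (+ 1 ℤ.* + 1)           ∎

ℕ→ℚ-≤⇔ : ∀ {a b} → (ℕ→ℚ a ℚ.≤ ℕ→ℚ b) ⇔ (a ≤ b)
ℕ→ℚ-≤⇔ {a} {b} = mk⇔
  (λ { (*≤* le) → ℤ.drop‿+≤+ (subst₂ ℤ._≤_ (ℤ.*-identityʳ (+ a)) (ℤ.*-identityʳ (+ b)) le) })
  (λ le → *≤* (subst₂ ℤ._≤_ (sym (ℤ.*-identityʳ (+ a))) (sym (ℤ.*-identityʳ (+ b))) (ℤ.+≤+ le)))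

ℕ→ℚ-homo-∑ : ∀ {m} (f : Fin m → ℕ) → foldr ℚ._+_ 0ℚ (tabulate (ℕ→ℚ ∘ f)) ≡ ℕ→ℚ (sum f)
ℕ→ℚ-homo-∑ {zero} f = refl
ℕ→ℚ-homo-∑ {suc m} f = trans (cong (ℕ→ℚ (f zero) ℚ.+_) (ℕ→ℚ-homo-∑ (f ∘ suc)))
                               (sym (ℕ→ℚ-homo-+ (f zero) (sum (f ∘ suc))))

AtMostOne : ∀ {m} → (Fin m → Set) → Set
AtMostOne P = ∀ i j → P i → P j → i ≡ j

≤∑ : ∀ {m} (f : Fin m → ℕ) i → f i ≤ sum f
≤∑ f zero    = ℕ.m≤m+n _ _
≤∑ f (suc i) = ℕ.≤-trans (≤∑ (f ∘ suc) i) (ℕ.m≤n+m _ (f zero))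

+≤∑ : ∀ {m} (f : Fin m → ℕ) {i j} → i ≢ j → f i + f j ≤ sum f
+≤∑ f {zero}  {zero}  i≢j = contradiction refl i≢j
+≤∑ f {zero}  {suc j} i≢j = ℕ.+-monoʳ-≤ (f zero) (≤∑ (f ∘ suc) j)
+≤∑ f {suc i} {zero}  i≢j =
  subst (_≤ sum f) (ℕ.+-comm (f zero) _) (+≤∑ f {zero} {suc i} (i≢j ∘ sym))
+≤∑ f {suc i} {suc j} i≢j = ℕ.≤-trans (+≤∑ (f ∘ suc) (i≢j ∘ cong suc)) (ℕ.m≤n+m _ (f zero))

∑≤1 : ∀ {m} (f : Fin m → ℕ) → (∀ i → f i ≤ 1) → AtMostOne (λ i → 0 < f i) → sum f ≤ 1
∑≤1 {zero}  f ≤1 one = z≤n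
∑≤1 {suc m} f ≤1 one with f zero in f₀≡
... | zero  = ∑≤1 (f ∘ suc) (≤1 ∘ suc) (λ i j p q → suc-injective (one (suc i) (suc j) p q))
... | suc x = begin
  suc x + sum (f ∘ suc) ≡⟨ cong (λ s → suc x + s) (trans (sum-cong-≗ tail≡0) (sum-replicate-zero m)) ⟩
  suc x + 0             ≡⟨ ℕ.+-identityʳ (suc x) ⟩
  suc x                 ≡⟨ f₀≡ ⟨
  f zero                ≤⟨ ≤1 zero ⟩
  1                     ∎
  where
  open ℕ.≤-Reasoning
  tail≡0 : ∀ i → f (suc i) ≡ 0
  tail≡0 i = ℕ.n≤0⇒n≡0 (ℕ.≮⇒≥ λ 0<fᵢ → contradiction (one zero (suc i) 0<f₀ 0<fᵢ) λ ())
    where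
    0<f₀ : 0 < f zero
    0<f₀ = subst (0 <_) (sym f₀≡) (s≤s z≤n)

∑≤1⇔ : ∀ {m} (f : Fin m → ℕ) → (sum f ≤ 1) ⇔ ((∀ i → f i ≤ 1) × AtMostOne (λ i → 0 < f i))
∑≤1⇔ f = mk⇔ (λ ∑f≤1 → (λ i → ℕ.≤-trans (≤∑ f i) ∑f≤1) , atMostOne ∑f≤1)
             (λ (≤1 , one) → ∑≤1 f ≤1 one)
  where
  atMostOne : sum f ≤ 1 → AtMostOne (λ i → 0 < f i)
  atMostOne ∑f≤1 i j 0<fᵢ 0<fⱼ with i ≟ j
  ... | yes i≡j = i≡j
  ... | no  i≢j =
    contradiction (ℕ.≤-trans (ℕ.+-mono-≤ 0<fᵢ 0<fⱼ) (ℕ.≤-trans (+≤∑ f i≢j) ∑f≤1)) λ { (s≤s ()) }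

+∸1≤⇔≤1 : ∀ k o → (k + o ∸ 1 ≤ k) ⇔ (o ≤ 1)
+∸1≤⇔≤1 k o = mk⇔ (to o) from
  where
  from : o ≤ 1 → k + o ∸ 1 ≤ k
  from o≤1 = ℕ.m≤n+o⇒m∸n≤o (k + o) 1 (subst (k + o ≤_) (ℕ.+-comm k 1) (ℕ.+-monoʳ-≤ k o≤1))
  to : ∀ o → k + o ∸ 1 ≤ k → o ≤ 1
  to zero          _ = z≤n
  to (suc zero)    _ = ℕ.≤-refl
  to (suc (suc o)) le = contradiction (subst (λ s → s ∸ 1 ≤ k) (ℕ.+-suc k (suc o)) le) (ℕ.m+1+n≰m k)

OmitsAtMostOne : ∀ {m} → (Fin m → Set) → Subset m → Set
OmitsAtMostOne P S = (∀ e → e ∉ S → P e) × AtMostOne (_∉ S)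

∉⇒lookup≡false : ∀ {m} {S : Subset m} {e} → e ∉ S → lookup S e ≡ false
∉⇒lookup≡false {S = S} {e} e∉ with lookup S e in eq
... | true  = contradiction (lookup⇒[]= e S eq) e∉
... | false = refl

module _ (G : Graph) {P : Fin (Graph.m G) → Set} (P? : Decidable P) where
  open Graph G

  cost : Fin m → ℕ
  cost e = if does (P? e) then 1 else 2

  threshold : ℚ
  threshold = ℕ→ℚ (sum cost ∸ 1)

  kept omitted : Subset m → Fin m → ℕ
  kept    S e = if lookup S e then cost e else 0
  omitted S e = if lookup S e then 0 else cost e

  weight≡∑kept : ∀ S → weight G (ℕ→ℚ ∘ cost) S ≡ ℕ→ℚ (sum (kept S))
  weight≡∑kept S = begin
    foldr ℚ._+_ 0ℚ (map (λ e → if lookup S e then ℕ→ℚ (cost e) else 0ℚ) (allFin m))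
      ≡⟨ cong (foldr ℚ._+_ 0ℚ) (map-cong (λ e → if-float ℕ→ℚ (lookup S e)) (allFin m)) ⟨
    foldr ℚ._+_ 0ℚ (map (ℕ→ℚ ∘ kept S) (allFin m))
      ≡⟨ cong (foldr ℚ._+_ 0ℚ) (map-tabulate (λ e → e) (ℕ→ℚ ∘ kept S)) ⟩
    foldr ℚ._+_ 0ℚ (tabulate (ℕ→ℚ ∘ kept S))
      ≡⟨ ℕ→ℚ-homo-∑ (kept S) ⟩
    ℕ→ℚ (sum (kept S)) ∎
    where open ≡-Reasoning

  ∑kept+∑omitted : ∀ S → sum (kept S) + sum (omitted S) ≡ sum cost
  ∑kept+∑omitted S = trans (sym (∑-distrib-+ (kept S) (omitted S))) (sum-cong-≗ kept+omitted)
    where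
    kept+omitted : ∀ e → kept S e + omitted S e ≡ cost e
    kept+omitted e with lookup S e
    ... | true  = ℕ.+-identityʳ (cost e)
    ... | false = refl

  0<cost : ∀ e → 0 < cost e
  0<cost e with P? e
  ... | yes _ = s≤s z≤n
  ... | no  _ = s≤s z≤n

  cost≤1⇔ : ∀ e → (cost e ≤ 1) ⇔ P e
  cost≤1⇔ e with P? e
  ... | yes p = mk⇔ (λ _ → p) (λ _ → ℕ.≤-refl)
  ... | no ¬p = mk⇔ (λ { (s≤s ()) }) (λ p → contradiction p ¬p)

  0<omitted⇔∉ : ∀ S e → (0 < omitted S e) ⇔ (e ∉ S)
  0<omitted⇔∉ S e with e ∈? S
  ... | yes e∈ rewrite []=⇒lookup e∈ = mk⇔ (λ ()) (λ e∉ → contradiction e∈ e∉)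
  ... | no  e∉ rewrite ∉⇒lookup≡false e∉ = mk⇔ (λ _ → e∉) (λ _ → 0<cost e)

  omitted≤1⇔ : ∀ S e → (omitted S e ≤ 1) ⇔ (e ∉ S → P e)
  omitted≤1⇔ S e with e ∈? S
  ... | yes e∈ rewrite []=⇒lookup e∈ = mk⇔ (λ _ e∉ → contradiction e∈ e∉) (λ _ → z≤n)
  ... | no  e∉ rewrite ∉⇒lookup≡false e∉ =
    mk⇔ (λ cost≤1 _ → Equivalence.to (cost≤1⇔ e) cost≤1)
        (λ onP → Equivalence.from (cost≤1⇔ e) (onP e∉))

  omitted-bounds⇔OmitsAtMostOne : ∀ S →
    ((∀ e → omitted S e ≤ 1) × AtMostOne (λ e → 0 < omitted S e)) ⇔ OmitsAtMostOne P S
  omitted-bounds⇔OmitsAtMostOne S = mk⇔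
    (λ (≤1 , one) → (λ e → to (omitted≤1⇔ S e) (≤1 e)) ,
                    (λ e f e∉ f∉ → one e f (from (0<omitted⇔∉ S e) e∉) (from (0<omitted⇔∉ S f) f∉)))
    (λ (onP , one) → (λ e → from (omitted≤1⇔ S e) (onP e)) ,
                     (λ e f 0<e 0<f → one e f (to (0<omitted⇔∉ S e) 0<e) (to (0<omitted⇔∉ S f) 0<f)))
    where open Equivalence

  threshold≤weight⇔ : ∀ S → (threshold ℚ.≤ weight G (ℕ→ℚ ∘ cost) S) ⇔ OmitsAtMostOne P S
  threshold≤weight⇔ S = begin
    threshold ℚ.≤ weight G (ℕ→ℚ ∘ cost) S
      ≡⟨ cong (threshold ℚ.≤_) (weight≡∑kept S) ⟩
    ℕ→ℚ (sum cost ∸ 1) ℚ.≤ ℕ→ℚ (sum (kept S))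
      ∼⟨ ℕ→ℚ-≤⇔ ⟩
    sum cost ∸ 1 ≤ sum (kept S)
      ≡⟨ cong (λ t → t ∸ 1 ≤ sum (kept S)) (∑kept+∑omitted S) ⟨
    sum (kept S) + sum (omitted S) ∸ 1 ≤ sum (kept S)
      ∼⟨ +∸1≤⇔≤1 (sum (kept S)) (sum (omitted S)) ⟩
    sum (omitted S) ≤ 1
      ∼⟨ ∑≤1⇔ (omitted S) ⟩
    ((∀ e → omitted S e ≤ 1) × AtMostOne (λ e → 0 < omitted S e))
      ∼⟨ omitted-bounds⇔OmitsAtMostOne S ⟩
    OmitsAtMostOne P S ∎
    where open EquationalReasoning

module _ {A : Set} {T : Rel A 0ℓ} where

  length : ∀ {x y} → Star T x y → ℕ
  length ε       = 0
  length (_ ◅ p) = suc (length p)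

  vertex : ∀ {x y} (p : Star T x y) → Fin (suc (length p)) → A
  vertex {x} p       zero    = x
  vertex     (_ ◅ p) (suc i) = vertex p i

  vertex-last : ∀ {x y} (p : Star T x y) → vertex p (fromℕ (length p)) ≡ y
  vertex-last ε       = refl
  vertex-last (_ ◅ p) = vertex-last p

  step-at : ∀ {x y} (p : Star T x y) (i : Fin (length p)) →
            T (vertex p (inject₁ i)) (vertex p (suc i))
  step-at (s ◅ p) zero    = s
  step-at (_ ◅ p) (suc i) = step-at p i

  IsPath : ∀ {x y} → Star T x y → Set
  IsPath     ε       = Unit
  IsPath {x} (_ ◅ p) = (∀ i → vertex p i ≢ x) × IsPath p

  IsPath⇒vertex-injective : ∀ {x y} (p : Star T x y) → IsPath p →
                            ∀ i j → vertex p i ≡ vertex p j → i ≡ j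
  IsPath⇒vertex-injective p       _           zero    zero    _  = refl
  IsPath⇒vertex-injective (_ ◅ p) (fresh , _) zero    (suc j) eq = contradiction (sym eq) (fresh j)
  IsPath⇒vertex-injective (_ ◅ p) (fresh , _) (suc i) zero    eq = contradiction eq (fresh i)
  IsPath⇒vertex-injective (_ ◅ p) (_ , path)  (suc i) (suc j) eq =
    cong suc (IsPath⇒vertex-injective p path i j eq)

  Path : A → A → Set
  Path x y = Σ (Star T x y) IsPath

  dropUntil : ∀ {x y} (p : Star T x y) → IsPath p → (i : Fin (suc (length p))) → Path (vertex p i) y
  dropUntil p       path       zero    = p , path
  dropUntil (_ ◅ p) (_ , path) (suc i) = dropUntil p path i

  module _ (_≟_ : DecidableEquality A) where

    _◅ₚ_ : ∀ {x y z} → T x y → Path y z → Path x z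
    _◅ₚ_ {x} {z = z} s (p , path) with any? (λ i → vertex p i ≟ x)
    ... | yes (i , vᵢ≡x) = subst (λ v → Path v z) vᵢ≡x (dropUntil p path i)
    ... | no  x∉p        = s ◅ p , (λ i vᵢ≡x → x∉p (i , vᵢ≡x)) , path

    toPath : ∀ {x y} → Star T x y → Path x y
    toPath ε       = ε , tt
    toPath (s ◅ p) = s ◅ₚ toPath p

  prefixWalk : ∀ {k} (f : Fin (suc k) → A) (j : Fin (suc k)) →
               (∀ (t : Fin k) → t <ᶠ j → T (f (inject₁ t)) (f (suc t))) → Star T (f zero) (f j)
  prefixWalk         f zero    _     = ε
  prefixWalk {suc k} f (suc j) steps =
    steps zero (s≤s z≤n) ◅ prefixWalk (f ∘ suc) j (λ t t<j → steps (suc t) (s≤s t<j))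

  suffixWalk : ∀ {k} (f : Fin (suc k) → A) (i : Fin (suc k)) →
               (∀ (t : Fin k) → i ≤ᶠ t → T (f (inject₁ t)) (f (suc t))) → Star T (f i) (f (fromℕ k))
  suffixWalk {zero}  f zero    _     = ε
  suffixWalk {suc k} f zero    steps =
    steps zero z≤n ◅ suffixWalk (f ∘ suc) zero (λ t _ → steps (suc t) z≤n)
  suffixWalk {suc k} f (suc i) steps = suffixWalk (f ∘ suc) i (λ t i≤t → steps (suc t) (s≤s i≤t))

module _ {n : ℕ} where

  SameEnds-sym : {x y : Fin n × Fin n} → SameEnds x y → SameEnds y x
  SameEnds-sym (inj₁ (refl , refl)) = inj₁ (refl , refl)
  SameEnds-sym (inj₂ (refl , refl)) = inj₂ (refl , refl)

  SameEnds-trans : {x y z : Fin n × Fin n} → SameEnds x y → SameEnds y z → SameEnds x z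
  SameEnds-trans (inj₁ (refl , refl)) yz                   = yz
  SameEnds-trans (inj₂ (refl , refl)) (inj₁ (refl , refl)) = inj₂ (refl , refl)
  SameEnds-trans (inj₂ (refl , refl)) (inj₂ (refl , refl)) = inj₁ (refl , refl)

  SameEnds-swap : {x : Fin n × Fin n} {a b : Fin n} → SameEnds x (a , b) → SameEnds x (b , a)
  SameEnds-swap (inj₁ (refl , refl)) = inj₂ (refl , refl)
  SameEnds-swap (inj₂ (refl , refl)) = inj₁ (refl , refl)

  SameEnds? : (x y : Fin n × Fin n) → Dec (SameEnds x y)
  SameEnds? (a , b) (c , d) = ((a ≟ c) ×-dec (b ≟ d)) ⊎-dec ((a ≟ d) ×-dec (b ≟ c))

module _ (G : Graph) where
  open Graph G

  edge-unique : ∀ {e f P} → SameEnds (ends e) P → SameEnds (ends f) P → e ≡ f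
  edge-unique {e} {f} eP fP = simple e f (SameEnds-trans eP (SameEnds-sym fP))

  Step-sym : ∀ {S x y} → Step G S x y → Step G S y x
  Step-sym (e , e∈ , se) = e , e∈ , SameEnds-swap se

  Star-sameEnds : ∀ {S x y a b} → SameEnds (x , y) (a , b) →
                  Star (Step G S) a b → Star (Step G S) x y
  Star-sameEnds (inj₁ (refl , refl)) p = p
  Star-sameEnds (inj₂ (refl , refl)) p = reverse Step-sym p

  keptStep : ∀ {S P x y} → (∀ g → g ∉ S → SameEnds (ends g) P) →
             ¬ SameEnds (x , y) P → Adj G x y → Step G S x y
  keptStep {S} omittedP ¬P (g , _ , sg) with g ∈? S
  ... | yes g∈ = g , g∈ , sg
  ... | no  g∉ = contradiction (SameEnds-trans (SameEnds-sym sg) (omittedP g g∉)) ¬P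

  onlyOmitted : ∀ {S} → AtMostOne (_∉ S) → ∀ {e P} → e ∉ S → SameEnds (ends e) P →
                ∀ g → g ∉ S → SameEnds (ends g) P
  onlyOmitted one e∉ eP g g∉ = subst (λ h → SameEnds (ends h) _) (one _ _ e∉ g∉) eP

  FundamentalCycle : Subset m → Fin m → Set
  FundamentalCycle S e = Σ (Cycle G) λ c → CycleEdge G c e × (∀ f → CycleEdge G c f → f ≡ e ⊎ f ∈ S)

  closePath : ∀ {S a b e} → e ∉ S → SameEnds (ends e) (a , b) → a ≢ b →
              Path {T = Step G S} b a → FundamentalCycle S e
  closePath e∉ eab a≢b (ε , _) = contradiction refl a≢b
  closePath {S} e∉ eab _ ((g , g∈ , gba) ◅ ε , _) =
    contradiction (subst (_∈ S) (sym (edge-unique eab (SameEnds-swap gba))) g∈) e∉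
  closePath {S} {a} {b} {e} e∉ eab _ (p@(_ ◅ _ ◅ _) , path) = cycle , inj₂ e-closes , rest
    where
    e-closes : SameEnds (ends e) (vertex p (fromℕ (length p)) , b)
    e-closes = subst (λ v → SameEnds (ends e) (v , b)) (sym (vertex-last p)) eab
    cycle : Cycle G
    cycle = record
      { k        = length p
      ; len≥3    = s≤s (s≤s z≤n)
      ; vs       = vertex p
      ; distinct = IsPath⇒vertex-injective p path
      ; consec   = λ i → let (g , _ , sg) = step-at p i in g , ∈⊤ , sg
      ; wrap     = e , ∈⊤ , e-closes
      }
    rest : ∀ f → CycleEdge G cycle f → f ≡ e ⊎ f ∈ S
    rest f (inj₁ (i , fᵢ)) =
      let (g , g∈ , gᵢ) = step-at p i in inj₂ (subst (_∈ S) (edge-unique gᵢ fᵢ) g∈)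
    rest f (inj₂ f-closes) = inj₁ (edge-unique f-closes e-closes)

  fundamentalCycle : ∀ {S} → ConnectedSub G S → ∀ {e} → e ∉ S → FundamentalCycle S e
  fundamentalCycle conn {e} e∉ =
    closePath e∉ (inj₁ (refl , refl)) (loopless e) (toPath _≟_ (conn (proj₂ (ends e)) (proj₁ (ends e))))

  module _ (c : Cycle G) where
    open Cycle c

    consec-injective : ∀ {t q} →
                       SameEnds (vs (inject₁ t) , vs (suc t)) (vs (inject₁ q) , vs (suc q)) → t ≡ q
    consec-injective         (inj₁ (tq , _))    = inject₁-injective (distinct _ _ tq)
    consec-injective {t} {q} (inj₂ (tq , tq′)) = contradiction q<t (ℕ.<-asym t<q)
      where
      q<t : toℕ q < toℕ t
      q<t = ℕ.≤-reflexive (trans (sym (cong toℕ (distinct _ _ tq))) (toℕ-inject₁ t))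
      t<q : toℕ t < toℕ q
      t<q = ℕ.≤-reflexive (trans (cong toℕ (distinct _ _ tq′)) (toℕ-inject₁ q))

    wrap≢consec : ∀ {q} → ¬ SameEnds (vs (fromℕ k) , vs zero) (vs (inject₁ q) , vs (suc q))
    wrap≢consec     (inj₁ (kq , _))   = fromℕ≢inject₁ (distinct _ _ kq)
    wrap≢consec {q} (inj₂ (kq , 0q)) = contradiction (subst (2 ≤_) k≡1 len≥3) λ { (s≤s ()) }
      where
      q≡0 : toℕ q ≡ 0
      q≡0 = trans (sym (toℕ-inject₁ q)) (cong toℕ (sym (distinct _ _ 0q)))
      k≡1 : k ≡ 1
      k≡1 = trans (sym (toℕ-fromℕ k)) (trans (cong toℕ (distinct _ _ kq)) (cong suc q≡0))

    cycleEdge? : Decidable (CycleEdge G c)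
    cycleEdge? e = any? (λ i → SameEnds? (ends e) _) ⊎-dec SameEnds? (ends e) _

    module _ {S : Subset m} where

      around-consec : ∀ q → (∀ g → g ∉ S → SameEnds (ends g) (vs (inject₁ q) , vs (suc q))) →
                      Star (Step G S) (vs (suc q)) (vs (inject₁ q))
      around-consec q omittedQ =
        suffixWalk vs (suc q) (λ t q<t → consecStep t (<⇒≢ q<t ∘ sym))
        ◅◅ keptStep omittedQ wrap≢consec wrap
        ◅  prefixWalk vs (inject₁ q) (λ t t<q → consecStep t (<⇒≢ (subst (toℕ t <_) (toℕ-inject₁ q) t<q)))
        where
        consecStep : ∀ t → t ≢ q → Step G S (vs (inject₁ t)) (vs (suc t))
        consecStep t t≢q = keptStep omittedQ (t≢q ∘ consec-injective) (consec t)

      around-wrap : (∀ g → g ∉ S → SameEnds (ends g) (vs (fromℕ k) , vs zero)) →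
                    Star (Step G S) (vs zero) (vs (fromℕ k))
      around-wrap omittedW =
        prefixWalk vs (fromℕ k) (λ t _ → keptStep omittedW (wrap≢consec ∘ SameEnds-sym) (consec t))

      omitted-bypassed : OmitsAtMostOne (CycleEdge G c) S →
                         ∀ {e} → e ∉ S → Star (Step G S) (proj₁ (ends e)) (proj₂ (ends e))
      omitted-bypassed (onCycle , one) {e} e∉ with onCycle e e∉
      ... | inj₁ (q , eq) = Star-sameEnds (SameEnds-swap eq) (around-consec q (onlyOmitted one e∉ eq))
      ... | inj₂ ew       = Star-sameEnds (SameEnds-swap ew) (around-wrap (onlyOmitted one e∉ ew))

    omits⇒connected : Connected G → ∀ {S} → OmitsAtMostOne (CycleEdge G c) S → ConnectedSub G S
    omits⇒connected conn {S} omits u v = (keptOrBypassed ⋆) (conn u v)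
      where
      keptOrBypassed : ∀ {x y} → Adj G x y → Star (Step G S) x y
      keptOrBypassed (e , _ , se) with e ∈? S
      ... | yes e∈ = return (e , e∈ , se)
      ... | no  e∉ = Star-sameEnds (SameEnds-sym se) (omitted-bypassed omits e∉)

    connected⇒omits : (∀ c′ e → CycleEdge G c e ⇔ CycleEdge G c′ e) →
                      ∀ {S} → ConnectedSub G S → OmitsAtMostOne (CycleEdge G c) S
    connected⇒omits unique {S} conn = onCycle , atMostOne
      where
      onCycle : ∀ e → e ∉ S → CycleEdge G c e
      onCycle e e∉ =
        let (c′ , e∈c′ , _) = fundamentalCycle conn e∉ in Equivalence.from (unique c′ e) e∈c′
      atMostOne : AtMostOne (_∉ S)
      atMostOne e f e∉ f∉ with fundamentalCycle conn e∉
      ... | c′ , _ , rest with rest f (Equivalence.to (unique c′ f) (onCycle f f∉))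
      ... | inj₁ f≡e = sym f≡e
      ... | inj₂ f∈  = contradiction f∈ f∉

corollary2 : ∀ (G : Graph) → ElementaryCycleWithArborescences G → Separable G
corollary2 G (connected , c , unique) =
  ℕ→ℚ ∘ cost G P? , (λ _ → Equivalence.from ℕ→ℚ-≤⇔ z≤n) , threshold G P? , λ S →
    mk⇔ (omits⇒connected G c connected) (connected⇒omits G c unique) ⇔-∘ threshold≤weight⇔ G P? S
  where
  P? : Decidable (CycleEdge G c)
  P? = cycleEdge? G c
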